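{- Let $\Sigma$ be a ranked alphabet containing a letter $a$ of arity $2$ and a letter $c$ of arity $0$, let $L \subseteq \mathsf{trees}\,\Sigma$ be recognised by a deterministic tree-walking automaton, and let $t \in \mathsf{trees}_2\{a,c\}$ be such that the $3$-ary terms $t(t(*,*),*)$ and $t(*,t(*,*))$ are $L$-equivalent. Let $\Gamma$ be the set of arity-$0$ letters of $\Sigma$. Then there is a regular word language $K \subseteq \Gamma^*$ such that for every $n \ge 2$, all $\sigma_1,\ldots,\sigma_n \in \Gamma$ and every $n$-ary term $s \in t^*$, $$\sigma_1 \cdots \sigma_n \in K \iff s(\sigma_1,\ldots,\sigma_n) \in L.$$
   Context: A ranked alphabet is a finite set in which each letter has an arity. A tree over $\Sigma$ is a finite sibling-ordered tree with nodes labelled by letters of $\Sigma$, a node with a label of arity $n$ having exactly $n$ children; $\mathsf{trees}\,\Sigma$ is the set of such trees. For $n \ge 0$, an $n$-ary term over $\Sigma$ is a tree over $\Sigma \cup \{*\}$, where $*$ is a fresh arity-$0$ letter occurring exactly $n$ times (its occurrences are ports, ordered left to right); $\mathsf{trees}_n\Sigma$ is the set of $n$-ary terms. For an $n$-ary term $t$ and terms $t_1,\ldots,t_n$, $t(t_1,\ldots,t_n)$ is the term obtained by substituting $t_i$ for the $i$-th port of $t$. Two terms $t, t' \in \mathsf{trees}_n\Sigma$ are $L$-equivalent if $s(t(s_1,\ldots,s_n)) \in L \iff s(t'(s_1,\ldots,s_n)) \in L$ for all $s \in \mathsf{trees}_1\Sigma$ and all $s_1,\ldots,s_n \in \mathsf{trees}\,\Sigma$.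 For $t \in \mathsf{trees}_2\Sigma$, $t^*$ is the smallest set of terms containing the unary term $*$ (a single port) and such that $t_1,t_2 \in t^*$ implies $t(t_1,t_2) \in t^*$. A deterministic tree-walking automaton over $\Sigma$ has finite state set $Q$, initial state $q_0$, and for each letter of arity $n$ a function $Q \times \{\text{root},1,\ldots,m\} \to \{\text{accept},\text{reject}\} \cup (Q \times \{\text{parent},1,\ldots,n\})$ ($m$ the maximal arity); starting at the root in $q_0$, at a node $v$ in state $q$ it applies the function of $v$'s label to $q$ and $v$'s child number (or "root"), and accepts, rejects, or changes state and moves to the parent or a child. The language it recognises is the set of trees on which the run ends with accept. -}

module Defs where

open import Data.Nat using (ℕ; zero; suc; _+_; _≤_; _⊔_)
open import Data.Nat.Properties using (m≤m⊔n; m≤n⊔m; ≤-trans)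
open import Data.Fin using (Fin; zero; suc; inject≤)
open import Data.Maybe using (Maybe; just; nothing)
open import Data.Bool using (Bool; true; false)
open import Data.Product using (Σ; _×_; _,_; proj₁; proj₂; ∃)
open import Data.List using (List; []; _∷_; foldl)
open import Data.Vec using (Vec; []; _∷_; lookup)
open import Data.Unit using (⊤)
open import Data.Empty using (⊥)
import Data.Sum
import Data.Vec
open import Relation.Binary.PropositionalEquality using (_≡_; subst; sym)
open import Function.Bundles using (_⇔_)

record RankedAlphabet : Set where
  field
    size  : ℕ
    arity : Fin size → ℕ

open RankedAlphabet public

Letter : RankedAlphabet → Set
Letter S = Fin (size S)

maxUpTo : (n : ℕ) → (Fin n → ℕ) → ℕ
maxUpTo zero    f = 0
maxUpTo (suc n) f = f zero ⊔ maxUpTo n (λ i → f (suc i))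

maxUpTo-ub : ∀ n (f : Fin n → ℕ) (i : Fin n) → f i ≤ maxUpTo n f
maxUpTo-ub (suc n) f zero    = m≤m⊔n (f zero) _
maxUpTo-ub (suc n) f (suc i) =
  ≤-trans (maxUpTo-ub n (λ j → f (suc j)) i) (m≤n⊔m (f zero) _)

maxArity : RankedAlphabet → ℕ
maxArity S = maxUpTo (size S) (arity S)

arity≤max : (S : RankedAlphabet) (x : Letter S) → arity S x ≤ maxArity S
arity≤max S x = maxUpTo-ub (size S) (arity S) x

data Tree (A : Set) (ar : A → ℕ) : Set where
  node : (x : A) → Vec (Tree A ar) (ar x) → Tree A ar

Trees : RankedAlphabet → Set
Trees S = Tree (Letter S) (arity S)

-- Σ ∪ {*}: `nothing` is the port letter *, of arity 0
arity* : (S : RankedAlphabet) → Maybe (Letter S) → ℕ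
arity* S nothing  = 0
arity* S (just x) = arity S x

Term : RankedAlphabet → Set
Term S = Tree (Maybe (Letter S)) (arity* S)

port : {S : RankedAlphabet} → Term S
port = node nothing []

module _ {S : RankedAlphabet} where

  -- number of ports (occurrences of *); t ∈ trees_n Σ iff ports t ≡ n
  mutual
    ports : Term S → ℕ
    ports (node nothing  _)  = 1
    ports (node (just x) cs) = portsV cs

    portsV : ∀ {n} → Vec (Term S) n → ℕ
    portsV []       = 0
    portsV (c ∷ cs) = ports c + portsV cs

  mutual
    substL : Term S → List (Term S) → Term S × List (Term S)
    substL (node nothing  cs) []       = node nothing cs , []
    substL (node nothing  cs) (u ∷ us) = u , us
    substL (node (just x) cs) us with substV cs us
    ... | cs' , us' = node (just x) cs' , us'

    substV : ∀ {n} → Vec (Term S) n → List (Term S) → Vec (Term S) n × List (Term S)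
    substV []       us = [] , us
    substV (c ∷ cs) us with substL c us
    ... | c' , us' with substV cs us'
    ... | cs' , us'' = (c' ∷ cs') , us''

  plug : Term S → List (Term S) → Term S
  plug t us = proj₁ (substL t us)

  mutual
    embed : Trees S → Term S
    embed (node x cs) = node (just x) (embedV cs)

    embedV : ∀ {n} → Vec (Trees S) n → Vec (Term S) n
    embedV []       = []
    embedV (c ∷ cs) = embed c ∷ embedV cs

  mutual
    toTree : Term S → Maybe (Trees S)
    toTree (node nothing  _)  = nothing
    toTree (node (just x) cs) with toTreeV cs
    ... | nothing  = nothing
    ... | just ds  = just (node x ds)

    toTreeV : ∀ {n} → Vec (Term S) n → Maybe (Vec (Trees S) n)
    toTreeV []       = just []
    toTreeV (c ∷ cs) with toTree c | toTreeV cs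
    ... | just d | just ds = just (d ∷ ds)
    ... | _      | _       = nothing

  InL : (Trees S → Set) → Term S → Set
  InL L u with toTree u
  ... | nothing = ⊥
  ... | just d  = L d

  LEquiv : (Trees S → Set) → (n : ℕ) → Term S → Term S → Set
  LEquiv L n t t' =
    (s : Term S) → ports s ≡ 1 → (ss : Vec (Trees S) n) →
    InL L (plug s (plug t  (Data.Vec.toList (embedV ss)) ∷ []))
      ⇔ InL L (plug s (plug t' (Data.Vec.toList (embedV ss)) ∷ []))

  mutual
    OverAC : Letter S → Letter S → Term S → Set
    OverAC a c (node nothing  cs) = ⊤
    OverAC a c (node (just x) cs) = ((x ≡ a) Data.Sum.⊎ (x ≡ c)) × OverACV a c cs

    OverACV : ∀ {n} → Letter S → Letter S → Vec (Term S) n → Set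
    OverACV a c []       = ⊤
    OverACV a c (d ∷ ds) = OverAC a c d × OverACV a c ds

  data InStar (t : Term S) : Term S → Set where
    star-port : InStar t port
    star-app  : ∀ {t₁ t₂} → InStar t t₁ → InStar t t₂ →
                InStar t (plug t (t₁ ∷ t₂ ∷ []))

  Γ : Set
  Γ = Σ (Letter S) (λ x → arity S x ≡ 0)

  leafT : Γ → Term S
  leafT (x , p) = node (just x) (subst (Vec (Term S)) (sym p) [])

data Move (n : ℕ) : Set where
  parent : Move n
  child  : Fin n → Move n

data Out (Q : ℕ) (n : ℕ) : Set where
  accept : Out Q n
  reject : Out Q n
  go     : Fin Q → Move n → Out Q n

record DTWA (S : RankedAlphabet) : Set where
  field
    nStates : ℕ
    q₀      : Fin nStates
    -- child number: nothing = root, just i = child number i+1 ∈ {1..m}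
    δ       : (x : Letter S) → Fin nStates →
              Maybe (Fin (maxArity S)) → Out nStates (arity S x)

module _ {S : RankedAlphabet} where

  data Ctx : Set where
    top   : Ctx
    frame : (x : Letter S) (i : Fin (arity S x))
            (cs : Vec (Trees S) (arity S x)) → Ctx → Ctx

  childNo : Ctx → Maybe (Fin (maxArity S))
  childNo top              = nothing
  childNo (frame x i _ _)  = just (inject≤ i (arity≤max S x))

  -- run with fuel; just true = accept, just false = reject (or an
  -- illegal move to the parent of the root), nothing = out of fuel
  run : (A : DTWA S) → ℕ → Fin (DTWA.nStates A) → Trees S → Ctx → Maybe Bool
  run A zero    q t ctx = nothing
  run A (suc k) q (node x cs) ctx with DTWA.δ A x q (childNo ctx)
  ... | accept = just true
  ... | reject = just false
  ... | go q' (child i) = run A k q' (lookup cs i) (frame x i cs ctx)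
  ... | go q' parent with ctx
  ...   | top = just false
  ...   | frame y j ds up = run A k q' (node y ds) up

  Accepts : DTWA S → Trees S → Set
  Accepts A t = ∃ λ k → run A k (DTWA.q₀ A) t top ≡ just true

  DTWARecognisable : (Trees S → Set) → Set
  DTWARecognisable L = ∃ λ (A : DTWA S) → (t : Trees S) → L t ⇔ Accepts A t

record DFA (G : Set) : Set where
  field
    nSt   : ℕ
    start : Fin nSt
    step  : Fin nSt → G → Fin nSt
    final : Fin nSt → Bool

DFAAccepts : {G : Set} → DFA G → List G → Set
DFAAccepts D w = DFA.final D (foldl (DFA.step D) (DFA.start D) w) ≡ true

Regular : {G : Set} → (List G → Set) → Set
Regular {G} K = ∃ λ (D : DFA G) → (w : List G) → K w ⇔ DFAAccepts D w

module Submission where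

-- A deterministic tree-walking automaton that enters a subtree at its root either accepts, rejects,
-- runs forever, or leaves the subtree upwards in some state.  This behaviour is a finite table, and
-- the table of a node is computed from its letter and the tables of its children (a run that keeps
-- returning to the node repeats a state, so it loops).  Hence membership in L is decided by
-- evaluating trees in a finite algebra of behaviours.  A term s ∈ t* filled with σ₁,…,σₙ is a
-- bracketing of σ₁⋯σₙ with t as the product; since t(t(*,*),*) and t(*,t(*,*)) are L-equivalent,
-- it can be rebracketed inside every context into the left comb ((σ₁σ₂)σ₃)⋯σₙ, and the behaviour of
-- the left comb is computed by a finite automaton reading σ₁⋯σₙ from left to right.

open import Defs
open import Data.Nat using (ℕ; zero; suc; _+_; _^_; _≤_; s≤s)
open import Data.Nat.Properties using (suc-injective; +-identityʳ; m+n≡0⇒m≡0; m+n≡0⇒n≡0; n<1+n)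
open import Data.Nat.ListAction using (sum)
open import Data.Nat.ListAction.Properties using (sum-++)
open import Data.Fin using (Fin; zero; suc; _<_; inject≤; funToFin; finToFun)
open import Data.Fin.Properties using (finToFun-funToFin; pigeonhole)
open import Data.Maybe using (Maybe; just; nothing)
open import Data.Bool using (Bool; true; false)
open import Data.Sum using (_⊎_; inj₁; inj₂; [_,_]′)
open import Data.Sum.Properties using (inj₁-injective)
open import Data.Product using (∃; ∃₂; _×_; _,_; proj₁; proj₂; map₁)
open import Data.List using (List; []; _∷_; _++_; length; foldl)
import Data.List as List
open import Data.List.Properties using (++-assoc; map-++; length-map; foldl-++)
open import Data.Vec using (Vec; []; _∷_; lookup; tabulate; toList; map)
open import Data.Vec.Properties using (tabulate-cong; tabulate∘lookup; lookup∘tabulate; length-toList; toList-map)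
open import Function.Base using (id; _∘_)
open import Function.Bundles using (_⇔_; mk⇔; _↪_; mk↪; RightInverse)
open import Function.Definitions using (StrictlyInverseʳ)
open import Function.Consequences.Propositional using (strictlyInverseʳ⇒inverseʳ)
open import Function.Properties.Equivalence using (⇔-isEquivalence; ⇔-setoid)
open import Level using (0ℓ)
open import Relation.Binary.Bundles using (Setoid)
open import Relation.Binary.Structures using (IsEquivalence)
open import Relation.Binary.Construct.Closure.ReflexiveTransitive using (Star; ε; _◅_; _◅◅_)
import Relation.Binary.Reasoning.Setoid as SetoidReasoning
open import Relation.Binary.PropositionalEquality

private
  variable
    A B : Set
    n k : ℕ

-- Finite encodings and regular languages

mk↪ₛ : (to : A → B) (from : B → A) → StrictlyInverseʳ _≡_ to from → A ↪ B
mk↪ₛ to from inv = mk↪ {to = to} {from = from} (strictlyInverseʳ⇒inverseʳ to inv)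

module _ (e : A ↪ Fin n) where
  open RightInverse e

  maybe↪ : Maybe A ↪ Fin (suc n)
  maybe↪ = mk↪ₛ to′ from′ from′-to′
    where
    to′ : Maybe A → Fin (suc n)
    to′ nothing  = zero
    to′ (just a) = suc (to a)
    from′ : Fin (suc n) → Maybe A
    from′ zero    = nothing
    from′ (suc i) = just (from i)
    from′-to′ : ∀ x → from′ (to′ x) ≡ x
    from′-to′ nothing  = refl
    from′-to′ (just a) = cong just (strictlyInverseʳ a)

  vec↪ : Vec A k ↪ Fin (n ^ k)
  vec↪ {k} = mk↪ₛ (λ v → funToFin (to ∘ lookup v)) (λ i → tabulate (from ∘ finToFun i)) from′-to′
    where
    open ≡-Reasoning
    from′-to′ : (v : Vec A k) → tabulate (from ∘ finToFun (funToFin (to ∘ lookup v))) ≡ v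
    from′-to′ v = begin
      tabulate (from ∘ finToFun (funToFin (to ∘ lookup v)))
        ≡⟨ tabulate-cong (cong from ∘ finToFun-funToFin (to ∘ lookup v)) ⟩
      tabulate (from ∘ to ∘ lookup v)
        ≡⟨ tabulate-cong (strictlyInverseʳ ∘ lookup v) ⟩
      tabulate (lookup v)
        ≡⟨ tabulate∘lookup v ⟩
      v ∎

record Automaton (G : Set) : Set₁ where
  field
    State : Set
    start : State
    step  : State → G → State
    final : State → Bool

  Language : List G → Set
  Language w = final (foldl step start w) ≡ true

automaton-regular : ∀ {G} (M : Automaton G) → Automaton.State M ↪ Fin n →
                    Regular (Automaton.Language M)
automaton-regular {G = G} M e =
  D , λ w → mk⇔ (subst (_≡ true) (final-run w)) (subst (_≡ true) (sym (final-run w)))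
  where
  open Automaton M
  open RightInverse e
  D : DFA G
  D = record { nSt = _ ; start = to start ; step = λ i σ → to (step (from i) σ) ; final = final ∘ from }
  run-to : ∀ w s → foldl (DFA.step D) (to s) w ≡ to (foldl step s w)
  run-to []      s = refl
  run-to (σ ∷ w) s rewrite strictlyInverseʳ s = run-to w (step s σ)
  final-run : ∀ w → final (foldl step start w) ≡ DFA.final D (foldl (DFA.step D) (DFA.start D) w)
  final-run w rewrite run-to w start = sym (cong final (strictlyInverseʳ _))

-- Evaluating terms in an algebra

data Split {A : Set} (m n : ℕ) : List A → Set where
  split : ∀ xs ys → length xs ≡ m → length ys ≡ n → Split m n (xs ++ ys)

split? : ∀ m {n} (ws : List A) → length ws ≡ m + n → Split m n ws
split? zero    ws       len = split [] ws refl len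
split? (suc m) (w ∷ ws) len with split? m ws (suc-injective len)
... | split xs ys lx ly = split (w ∷ xs) ys (cong suc lx) ly

-- A port left without input evaluates to unfilled, as substL leaves such a port in place.
record Algebra (S : RankedAlphabet) : Set₁ where
  field
    Carrier  : Set
    op       : (x : Letter S) → Vec Carrier (arity S x) → Carrier
    unfilled : Carrier

module Evaluation {S : RankedAlphabet} (α : Algebra S) where
  open Algebra α

  mutual
    eval : Term S → List Carrier → Carrier × List Carrier
    eval (node nothing  _)  []       = unfilled , []
    eval (node nothing  _)  (u ∷ us) = u , us
    eval (node (just x) cs) us       = map₁ (op x) (evalV cs us)

    evalV : Vec (Term S) n → List Carrier → Vec Carrier n × List Carrier
    evalV []       us = [] , us
    evalV (c ∷ cs) us =
      proj₁ (eval c us) ∷ proj₁ (evalV cs (proj₂ (eval c us))) , proj₂ (evalV cs (proj₂ (eval c us)))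

  evals : List (Term S) → List Carrier → List Carrier × List Carrier
  evals []       us = [] , us
  evals (w ∷ ws) us =
    proj₁ (eval w us) ∷ proj₁ (evals ws (proj₂ (eval w us))) , proj₂ (evals ws (proj₂ (eval w us)))

  length-evals : ∀ ws us → length (proj₁ (evals ws us)) ≡ length ws
  length-evals []       us = refl
  length-evals (w ∷ ws) us = cong suc (length-evals ws _)

  evals-++ : ∀ xs ys us → evals (xs ++ ys) us ≡
    (proj₁ (evals xs us) ++ proj₁ (evals ys (proj₂ (evals xs us))) , proj₂ (evals ys (proj₂ (evals xs us))))
  evals-++ []       ys us = refl
  evals-++ (x ∷ xs) ys us rewrite evals-++ xs ys (proj₂ (eval x us)) = refl

  mutual
    eval-++ : ∀ t ws zs → length ws ≡ ports t → eval t (ws ++ zs) ≡ (proj₁ (eval t ws) , zs)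
    eval-++ (node nothing  []) (w ∷ []) zs len = refl
    eval-++ (node (just x) cs) ws       zs len rewrite evalV-++ cs ws zs len = refl

    evalV-++ : (cs : Vec (Term S) n) (ws zs : List Carrier) → length ws ≡ portsV cs →
               evalV cs (ws ++ zs) ≡ (proj₁ (evalV cs ws) , zs)
    evalV-++ []       [] zs len = refl
    evalV-++ (c ∷ cs) ws zs len with split? (ports c) ws len
    ... | split xs ys lx ly
      rewrite ++-assoc xs ys zs | eval-++ c xs (ys ++ zs) lx | eval-++ c xs ys lx | evalV-++ cs ys zs ly
      = refl

  value : Term S → Carrier
  value u = proj₁ (eval u [])

  mutual
    hom : Trees S → Carrier
    hom (node x cs) = op x (homV cs)

    homV : Vec (Trees S) n → Vec Carrier n
    homV []       = []
    homV (c ∷ cs) = hom c ∷ homV cs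

  mutual
    eval-embed : ∀ d us → eval (embed d) us ≡ (hom d , us)
    eval-embed (node x cs) us rewrite evalV-embedV cs us = refl

    evalV-embedV : (cs : Vec (Trees S) n) (us : List Carrier) → evalV (embedV cs) us ≡ (homV cs , us)
    evalV-embedV []       us = refl
    evalV-embedV (c ∷ cs) us rewrite eval-embed c us | evalV-embedV cs us = refl

  value-embed : ∀ d → value (embed d) ≡ hom d
  value-embed d = cong proj₁ (eval-embed d [])

module _ {S : RankedAlphabet} where

  termAlgebra : Algebra S
  termAlgebra = record { Carrier = Term S ; op = λ x → node (just x) ; unfilled = port }

  open Evaluation termAlgebra using () renaming (eval to evalT; evalV to evalTV; evals to plugs)

  mutual
    substL≡evalT : ∀ t us → substL t us ≡ evalT t us
    substL≡evalT (node nothing  []) []       = refl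
    substL≡evalT (node nothing  []) (u ∷ us) = refl
    substL≡evalT (node (just x) cs) us rewrite substV≡evalTV cs us = refl

    substV≡evalTV : (cs : Vec (Term S) n) (us : List (Term S)) → substV cs us ≡ evalTV cs us
    substV≡evalTV []       us = refl
    substV≡evalTV (c ∷ cs) us rewrite substL≡evalT c us | substV≡evalTV cs (proj₂ (evalT c us)) = refl

  plug≡evalT : ∀ t us → plug t us ≡ proj₁ (evalT t us)
  plug≡evalT t us = cong proj₁ (substL≡evalT t us)

  module Composition (α : Algebra S) where
    open Algebra α
    open Evaluation α

    mutual
      eval-evalT : ∀ t ws us → length ws ≡ ports t →
                   eval (proj₁ (evalT t ws)) us ≡ (proj₁ (eval t (proj₁ (evals ws us))) , proj₂ (evals ws us))
      eval-evalT (node nothing  []) (w ∷ []) us len = refl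
      eval-evalT (node (just x) cs) ws       us len rewrite evalV-evalTV cs ws us len = refl

      evalV-evalTV : (cs : Vec (Term S) n) (ws : List (Term S)) (us : List Carrier) → length ws ≡ portsV cs →
                     evalV (proj₁ (evalTV cs ws)) us ≡ (proj₁ (evalV cs (proj₁ (evals ws us))) , proj₂ (evals ws us))
      evalV-evalTV []       [] us len = refl
      evalV-evalTV (c ∷ cs) ws us len with split? (ports c) ws len
      ... | split xs ys lx ly
        rewrite Evaluation.eval-++ termAlgebra c xs ys lx
              | eval-evalT c xs us lx
              | evalV-evalTV cs ys (proj₂ (evals xs us)) ly
              | evals-++ xs ys us
              | eval-++ c (proj₁ (evals xs us)) (proj₁ (evals ys (proj₂ (evals xs us))))
                        (trans (length-evals xs us) lx)
        = refl

    eval-plug : ∀ t ws us → length ws ≡ ports t →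
                eval (plug t ws) us ≡ (proj₁ (eval t (proj₁ (evals ws us))) , proj₂ (evals ws us))
    eval-plug t ws us len rewrite plug≡evalT t ws = eval-evalT t ws us len

    value-plug₂ : ∀ t u v → ports t ≡ 2 → ports u ≡ 0 →
                  value (plug t (u ∷ v ∷ [])) ≡ proj₁ (eval t (value u ∷ value v ∷ []))
    value-plug₂ t u v two closed
      rewrite eval-plug t (u ∷ v ∷ []) [] (sym two) | cong proj₂ (eval-++ u [] [] (sym closed))
      = refl

  plug-plug : ∀ t ws us → length ws ≡ ports t → plug (plug t ws) us ≡ plug t (proj₁ (plugs ws us))
  plug-plug t ws us len rewrite plug≡evalT (plug t ws) us | plug≡evalT t (proj₁ (plugs ws us)) =
    cong proj₁ (Composition.eval-plug termAlgebra t ws us len)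

  mutual
    evalT-[] : ∀ u → evalT u [] ≡ (u , [])
    evalT-[] (node nothing  []) = refl
    evalT-[] (node (just x) cs) rewrite evalTV-[] cs = refl

    evalTV-[] : (cs : Vec (Term S) n) → evalTV cs [] ≡ (cs , [])
    evalTV-[] []       = refl
    evalTV-[] (c ∷ cs) rewrite evalT-[] c | evalTV-[] cs = refl

  mutual
    ports-evalT : ∀ t ws → length ws ≡ ports t → ports (proj₁ (evalT t ws)) ≡ sum (List.map ports ws)
    ports-evalT (node nothing  []) (w ∷ []) len = sym (+-identityʳ (ports w))
    ports-evalT (node (just x) cs) ws       len = ports-evalTV cs ws len

    ports-evalTV : (cs : Vec (Term S) n) (ws : List (Term S)) → length ws ≡ portsV cs →
                   portsV (proj₁ (evalTV cs ws)) ≡ sum (List.map ports ws)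
    ports-evalTV []       [] len = refl
    ports-evalTV (c ∷ cs) ws len with split? (ports c) ws len
    ... | split xs ys lx ly
      rewrite Evaluation.eval-++ termAlgebra c xs ys lx | ports-evalT c xs lx | ports-evalTV cs ys ly
            | map-++ ports xs ys | sum-++ (List.map ports xs) (List.map ports ys)
      = refl

  ports-plug : ∀ t ws → length ws ≡ ports t → ports (plug t ws) ≡ sum (List.map ports ws)
  ports-plug t ws len rewrite plug≡evalT t ws = ports-evalT t ws len

  mutual
    closed⇒embed : ∀ u → ports u ≡ 0 → ∃ λ d → u ≡ embed {S} d
    closed⇒embed (node nothing  _)  ()
    closed⇒embed (node (just x) cs) closed with closedV⇒embedV cs closed
    ... | ds , eq = node x ds , cong (node (just x)) eq

    closedV⇒embedV : (cs : Vec (Term S) n) → portsV cs ≡ 0 → ∃ λ ds → cs ≡ embedV ds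
    closedV⇒embedV []       closed = [] , refl
    closedV⇒embedV (c ∷ cs) closed with closed⇒embed c (m+n≡0⇒m≡0 (ports c) closed)
                                   | closedV⇒embedV cs (m+n≡0⇒n≡0 (ports c) closed)
    ... | d , eq | ds , eqs = d ∷ ds , cong₂ _∷_ eq eqs

  mutual
    toTree-embed : ∀ d → toTree (embed {S} d) ≡ just d
    toTree-embed (node x cs) rewrite toTreeV-embedV cs = refl

    toTreeV-embedV : (ds : Vec (Trees S) n) → toTreeV (embedV {S} ds) ≡ just ds
    toTreeV-embedV []       = refl
    toTreeV-embedV (d ∷ ds) rewrite toTree-embed d | toTreeV-embedV ds = refl

  InL-embed : (L : Trees S → Set) (d : Trees S) → InL L (embed {S} d) ≡ L d
  InL-embed L d rewrite toTree-embed d = refl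

  plug-[] : ∀ u → plug u [] ≡ u
  plug-[] u = trans (plug≡evalT u []) (cong proj₁ (evalT-[] u))

  plug-plug₁ : ∀ s r xs → ports s ≡ 1 → length xs ≡ ports r →
               plug (plug s (r ∷ [])) xs ≡ plug s (plug r xs ∷ [])
  plug-plug₁ s r xs one len rewrite plug-plug s (r ∷ []) xs (sym one) | plug≡evalT r xs = refl

  plug-plug₂ : ∀ t u v xs ys → ports t ≡ 2 → length xs ≡ ports u →
               plug (plug t (u ∷ v ∷ [])) (xs ++ ys) ≡ plug t (plug u xs ∷ plug v ys ∷ [])
  plug-plug₂ t u v xs ys two len
    rewrite plug-plug t (u ∷ v ∷ []) (xs ++ ys) (sym two)
          | Evaluation.eval-++ termAlgebra u xs ys len | plug≡evalT u xs | plug≡evalT v ys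
    = refl

-- Runs and behaviours of a tree-walking automaton

module TreeWalking {S : RankedAlphabet} (A : DTWA S) where
  open DTWA A

  Config : Set
  Config = Fin nStates × Trees S × Ctx {S}

  moveUp : Fin nStates → Ctx {S} → Bool ⊎ Config
  moveUp q top                = inj₁ false
  moveUp q (frame y j ds ctx) = inj₂ (q , node y ds , ctx)

  perform : (x : Letter S) → Vec (Trees S) (arity S x) → Ctx {S} → Out nStates (arity S x) → Bool ⊎ Config
  perform x cs ctx accept           = inj₁ true
  perform x cs ctx reject           = inj₁ false
  perform x cs ctx (go q parent)    = moveUp q ctx
  perform x cs ctx (go q (child i)) = inj₂ (q , lookup cs i , frame x i cs ctx)

  step : Config → Bool ⊎ Config
  step (q , node x cs , ctx) = perform x cs ctx (δ x q (childNo ctx))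

  runFrom : ℕ → Config → Maybe Bool
  runFrom zero    c = nothing
  runFrom (suc k) c = [ just , runFrom k ]′ (step c)

  run≡runFrom : ∀ k q d ctx → run A k q d ctx ≡ runFrom k (q , d , ctx)
  run≡runFrom zero    q d           ctx = refl
  run≡runFrom (suc k) q (node x cs) ctx with δ x q (childNo ctx)
  ... | accept          = refl
  ... | reject          = refl
  ... | go q′ (child i) = run≡runFrom k q′ (lookup cs i) (frame x i cs ctx)
  ... | go q′ parent with ctx
  ...   | top               = refl
  ...   | frame y j ds ctx′ = run≡runFrom k q′ (node y ds) ctx′

  infix 4 _⟶_ _⟶*_ _⇝_

  _⟶_ : Config → Config → Set
  c ⟶ c′ = step c ≡ inj₂ c′

  _⟶*_ : Config → Config → Set
  _⟶*_ = Star _⟶_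

  _⇝_ : Config → Bool ⊎ Config → Set
  c ⇝ o = ∃ λ c′ → c ⟶* c′ × step c′ ≡ o

  Diverges : Config → Set
  Diverges c = ∀ k → runFrom k c ≡ nothing

  ⟶*-⇝ : ∀ {c c′ o} → c ⟶* c′ → c′ ⇝ o → c ⇝ o
  ⟶*-⇝ path (c″ , path′ , s) = c″ , path ◅◅ path′ , s

  ⇝⇒⟶* : ∀ {c c′} → c ⇝ inj₂ c′ → c ⟶* c′
  ⇝⇒⟶* (_ , path , s) = path ◅◅ (s ◅ ε)

  ⇝-⟶* : ∀ {c c′ c″} → c ⇝ inj₂ c′ → c′ ⟶* c″ → c ⇝ inj₂ c″
  ⇝-⟶* m ε        = m
  ⇝-⟶* m (x ◅ xs) = ⇝-⟶* (_ , ⇝⇒⟶* m , x) xs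

  ⟶-diverges : ∀ {c c′} → c ⟶ c′ → Diverges c′ → Diverges c
  ⟶-diverges s div zero    = refl
  ⟶-diverges s div (suc k) = trans (cong [ just , runFrom k ]′ s) (div k)

  ⟶*-diverges : ∀ {c c′} → c ⟶* c′ → Diverges c′ → Diverges c
  ⟶*-diverges ε        div = div
  ⟶*-diverges (x ◅ xs) div = ⟶-diverges x (⟶*-diverges xs div)

  ⇝⇒runFrom : ∀ {c b} → c ⇝ inj₁ b → ∃ λ k → runFrom k c ≡ just b
  ⇝⇒runFrom (_ , ε , s)      = 1 , cong [ just , runFrom 0 ]′ s
  ⇝⇒runFrom (_ , x ◅ xs , s) with ⇝⇒runFrom (_ , xs , s)
  ... | k , r = suc k , trans (cong [ just , runFrom k ]′ x) r

  runFrom⇒⇝ : ∀ k {c b} → runFrom k c ≡ just b → c ⇝ inj₁ b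
  runFrom⇒⇝ (suc k) {c} r with step c in s
  ... | inj₁ b′ with refl ← r = c , ε , s
  ... | inj₂ c′ = ⟶*-⇝ (s ◅ ε) (runFrom⇒⇝ k r)

  halting-deterministic : ∀ {c b b′} → c ⇝ inj₁ b → c ⇝ inj₁ b′ → b ≡ b′
  halting-deterministic (_ , xs , s) (_ , ys , s′) = paths xs s ys s′
    where
    paths : ∀ {c c₁ c₂ b b′} → c ⟶* c₁ → step c₁ ≡ inj₁ b → c ⟶* c₂ → step c₂ ≡ inj₁ b′ → b ≡ b′
    paths ε        s ε        s′ = inj₁-injective (trans (sym s) s′)
    paths ε        s (y ◅ _)  _  with () ← trans (sym s) y
    paths (x ◅ _)  _ ε        s′ with () ← trans (sym x) s′
    paths (x ◅ xs) s (y ◅ ys) s′ with refl ← trans (sym x) y = paths xs s ys s′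

  cycle-diverges : ∀ {c c′} → c ⇝ inj₂ c → c′ ⟶* c → Diverges c′
  cycle-diverges cyc path zero = refl
  cycle-diverges cyc path (suc k) with next cyc path
    where
    next : ∀ {c c′} → c ⇝ inj₂ c → c′ ⟶* c → ∃ λ c₂ → c′ ⟶ c₂ × c₂ ⟶* c
    next _                (x ◅ xs) = _ , x , xs
    next (_ , ε , s)      ε        = _ , s , ε
    next (_ , x ◅ xs , s) ε        = _ , x , xs ◅◅ (s ◅ ε)
  ... | _ , s , path′ = trans (cong [ just , runFrom k ]′ s) (cycle-diverges cyc path′ k)

  M : ℕ
  M = maxArity S

  data Outcome : Set where
    accepts rejects loops : Outcome
    exits : Fin nStates → Outcome

  Realises : Config → Outcome → Set
  Realises c             accepts    = c ⇝ inj₁ true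
  Realises c             rejects    = c ⇝ inj₁ false
  Realises c             loops      = Diverges c
  Realises (q , d , ctx) (exits q′) = (q , d , ctx) ⇝ moveUp q′ ctx

  ⟶*-Realises : ∀ {q q′ d ctx} o → (q , d , ctx) ⟶* (q′ , d , ctx) →
                Realises (q′ , d , ctx) o → Realises (q , d , ctx) o
  ⟶*-Realises accepts   path r = ⟶*-⇝ path r
  ⟶*-Realises rejects   path r = ⟶*-⇝ path r
  ⟶*-Realises loops     path r = ⟶*-diverges path r
  ⟶*-Realises (exits _) path r = ⟶*-⇝ path r

  -- One outcome per entry state and child number of the subtree's root; slot zero is the root of the tree.
  Behaviour : Set
  Behaviour = Vec (Vec Outcome nStates) (suc M)

  slot : Maybe (Fin M) → Fin (suc M)
  slot nothing  = zero
  slot (just i) = suc i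

  unslot : Fin (suc M) → Maybe (Fin M)
  unslot zero    = nothing
  unslot (suc i) = just i

  unslot-slot : ∀ cn → unslot (slot cn) ≡ cn
  unslot-slot nothing  = refl
  unslot-slot (just i) = refl

  outcome : Behaviour → Maybe (Fin M) → Fin nStates → Outcome
  outcome b cn q = lookup (lookup b (slot cn)) q

  tabulateBehaviour : (Maybe (Fin M) → Fin nStates → Outcome) → Behaviour
  tabulateBehaviour f = tabulate λ k → tabulate (f (unslot k))

  outcome-tabulate : ∀ f cn q → outcome (tabulateBehaviour f) cn q ≡ f cn q
  outcome-tabulate f cn q rewrite lookup∘tabulate (λ k → tabulate (f (unslot k))) (slot cn)
                                | unslot-slot cn = lookup∘tabulate (f cn) q

  returns : Outcome → Outcome ⊎ Fin nStates
  returns accepts   = inj₁ accepts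
  returns rejects   = inj₁ rejects
  returns loops     = inj₁ loops
  returns (exits q) = inj₂ q

  localStep : (x : Letter S) → Vec Behaviour (arity S x) → Out nStates (arity S x) → Outcome ⊎ Fin nStates
  localStep x bs accept           = inj₁ accepts
  localStep x bs reject           = inj₁ rejects
  localStep x bs (go q parent)    = inj₁ (exits q)
  localStep x bs (go q (child i)) = returns (outcome (lookup bs i) (just (inject≤ i (arity≤max S x))) q)

  iterate : (Fin nStates → Outcome ⊎ Fin nStates) → ℕ → Fin nStates → Outcome
  iterate f zero    q = loops
  iterate f (suc k) q = [ id , iterate f k ]′ (f q)

  -- nStates rounds suffice: a run returning to the node more often repeats a state, hence loops.
  nodeBehaviour : (x : Letter S) → Vec Behaviour (arity S x) → Behaviour
  nodeBehaviour x bs = tabulateBehaviour λ cn → iterate (λ q → localStep x bs (δ x q cn)) nStates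

  behaviourAlgebra : Algebra S
  behaviourAlgebra = record
    { Carrier  = Behaviour
    ; op       = nodeBehaviour
    ; unfilled = tabulateBehaviour λ _ _ → loops
    }

  open Evaluation behaviourAlgebra using (hom; homV)

  lookup-homV : ∀ {n} (cs : Vec (Trees S) n) i → lookup (homV cs) i ≡ hom (lookup cs i)
  lookup-homV (c ∷ cs) zero    = refl
  lookup-homV (c ∷ cs) (suc i) = lookup-homV cs i

  Sound : Trees S → Set
  Sound d = ∀ q ctx → Realises (q , d , ctx) (outcome (hom d) (childNo ctx) q)

  module NodeSoundness (x : Letter S) (cs : Vec (Trees S) (arity S x))
                       (sound : ∀ i → Sound (lookup cs i)) (ctx : Ctx {S}) where

    at : Fin nStates → Config
    at q = q , node x cs , ctx

    MoveRealises : Fin nStates → Outcome ⊎ Fin nStates → Set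
    MoveRealises q (inj₁ o)  = Realises (at q) o
    MoveRealises q (inj₂ q′) = at q ⇝ inj₂ (at q′)

    descend : ∀ {q q′} i o → at q ⟶ (q′ , lookup cs i , frame x i cs ctx) →
              Realises (q′ , lookup cs i , frame x i cs ctx) o → MoveRealises q (returns o)
    descend i accepts   e r = ⟶*-⇝ (e ◅ ε) r
    descend i rejects   e r = ⟶*-⇝ (e ◅ ε) r
    descend i loops     e r = ⟶-diverges e r
    descend i (exits _) e r = ⟶*-⇝ (e ◅ ε) r

    move : Fin nStates → Outcome ⊎ Fin nStates
    move q = localStep x (homV cs) (δ x q (childNo ctx))

    move-sound : ∀ q → MoveRealises q (move q)
    move-sound q with δ x q (childNo ctx) in eq
    ... | accept          = at q , ε , cong (perform x cs ctx) eq
    ... | reject          = at q , ε , cong (perform x cs ctx) eq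
    ... | go q′ parent    = at q , ε , cong (perform x cs ctx) eq
    ... | go q′ (child i) rewrite lookup-homV cs i =
      descend i _ (cong (perform x cs ctx) eq) (sound i q′ (frame x i cs ctx))

    data Walk : ℕ → Fin nStates → Set where
      []  : ∀ {q} → Walk 0 q
      _∷_ : ∀ {k q q′} → at q ⇝ inj₂ (at q′) → Walk k q′ → Walk (suc k) q

    visit : ∀ {k q} → Walk k q → Fin (suc k) → Fin nStates
    visit {q = q} w        zero    = q
    visit         (_ ∷ w) (suc i) = visit w i

    visit-reachable : ∀ {k q} (w : Walk k q) i → at q ⟶* at (visit w i)
    visit-reachable w       zero    = ε
    visit-reachable (m ∷ w) (suc i) = ⇝⇒⟶* m ◅◅ visit-reachable w i

    visit-later : ∀ {k q} (w : Walk k q) i j → i < j → at (visit w i) ⇝ inj₂ (at (visit w j))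
    visit-later (m ∷ w) zero    (suc j) _         = ⇝-⟶* m (visit-reachable w j)
    visit-later (m ∷ w) (suc i) (suc j) (s≤s i<j) = visit-later w i j i<j

    long-walk-diverges : ∀ {q} → Walk nStates q → Diverges (at q)
    long-walk-diverges w with pigeonhole (n<1+n nStates) (visit w)
    ... | i , j , i<j , same = ⟶*-diverges (visit-reachable w i)
      (cycle-diverges (subst (λ q → at (visit w i) ⇝ inj₂ (at q)) (sym same) (visit-later w i j i<j)) ε)

    iterate-sound : ∀ k q → Realises (at q) (iterate move k q) ⊎ (iterate move k q ≡ loops × Walk k q)
    iterate-sound zero    q = inj₂ (refl , [])
    iterate-sound (suc k) q with move q | move-sound q
    ... | inj₁ o  | r = inj₁ r
    ... | inj₂ q′ | m with iterate-sound k q′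
    ...   | inj₁ r         = inj₁ (⟶*-Realises (iterate move k q′) (⇝⇒⟶* m) r)
    ...   | inj₂ (e , w)   = inj₂ (e , m ∷ w)

    node-sound : ∀ q → Realises (at q) (outcome (hom (node x cs)) (childNo ctx) q)
    node-sound q
      rewrite outcome-tabulate (λ cn → iterate (λ q → localStep x (homV cs) (δ x q cn)) nStates) (childNo ctx) q
      with iterate-sound nStates q
    ... | inj₁ r       = r
    ... | inj₂ (e , w) rewrite e = long-walk-diverges w

  mutual
    behaviour-sound : ∀ d → Sound d
    behaviour-sound (node x cs) q ctx = NodeSoundness.node-sound x cs (children-sound cs) ctx q

    children-sound : ∀ {n} (cs : Vec (Trees S) n) i → Sound (lookup cs i)
    children-sound (c ∷ cs) zero    = behaviour-sound c
    children-sound (c ∷ cs) (suc i) = children-sound cs i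

  accepting : Outcome → Bool
  accepting accepts = true
  accepting _       = false

  accepts⇔accepting : ∀ d → Accepts A d ⇔ accepting (outcome (hom d) nothing q₀) ≡ true
  accepts⇔accepting d = mk⇔ (to _ (behaviour-sound d q₀ top)) (from _ (behaviour-sound d q₀ top))
    where
    initial : Config
    initial = q₀ , d , top

    accepted : Accepts A d → initial ⇝ inj₁ true
    accepted (k , r) = runFrom⇒⇝ k (trans (sym (run≡runFrom k q₀ d top)) r)

    to : ∀ o → Realises initial o → Accepts A d → accepting o ≡ true
    to accepts   _   _   = refl
    to rejects   r   acc with () ← halting-deterministic (accepted acc) r
    to (exits _) r   acc with () ← halting-deterministic (accepted acc) r
    to loops     div acc with k , r ← ⇝⇒runFrom (accepted acc) with () ← trans (sym (div k)) r

    from : ∀ o → Realises initial o → accepting o ≡ true → Accepts A d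
    from accepts r _ with k , r′ ← ⇝⇒runFrom r = k , trans (run≡runFrom k q₀ d top) r′

-- Bracketings of words with t as the product

module Bracketings {S : RankedAlphabet} (t : Term S) (binary : ports t ≡ 2) where

  infixl 6 _∙_

  data Bracketing : Set where
    letter : Γ {S} → Bracketing
    _∙_    : Bracketing → Bracketing → Bracketing

  ⟦_⟧ : Bracketing → Term S
  ⟦ letter σ ⟧ = leafT σ
  ⟦ e ∙ f ⟧    = plug t (⟦ e ⟧ ∷ ⟦ f ⟧ ∷ [])

  letters : Bracketing → List (Γ {S})
  letters (letter σ) = σ ∷ []
  letters (e ∙ f)    = letters e ++ letters f

  leftComb : Bracketing → List (Γ {S}) → Bracketing
  leftComb = foldl λ e τ → e ∙ letter τ

  ports-plug-pair : ∀ u v → ports (plug t (u ∷ v ∷ [])) ≡ ports u + ports v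
  ports-plug-pair u v = trans (ports-plug t (u ∷ v ∷ []) (sym binary)) (cong (ports u +_) (+-identityʳ (ports v)))

  ports-leafT : ∀ σ → ports (leafT {S} σ) ≡ 0
  ports-leafT (x , p) = no-ports p
    where
    no-ports : ∀ {k} (p : k ≡ 0) → portsV (subst (Vec (Term S)) (sym p) []) ≡ 0
    no-ports refl = refl

  closed : ∀ e → ports ⟦ e ⟧ ≡ 0
  closed (letter σ) = ports-leafT σ
  closed (e ∙ f) rewrite ports-plug-pair ⟦ e ⟧ ⟦ f ⟧ | closed e | closed f = refl

  star-bracketing : ∀ {s} → InStar t s → ∀ σs → length σs ≡ ports s →
                    ∃ λ e → letters e ≡ σs × plug s (List.map leafT σs) ≡ ⟦ e ⟧
  star-bracketing star-port (σ ∷ []) _ = letter σ , refl , refl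
  star-bracketing (star-app {s₁} {s₂} in₁ in₂) σs len
    with split? (ports s₁) σs (trans len (ports-plug-pair s₁ s₂))
  ... | split xs ys lx ly
    with e₁ , l₁ , p₁ ← star-bracketing in₁ xs lx | e₂ , l₂ , p₂ ← star-bracketing in₂ ys ly =
    e₁ ∙ e₂ , cong₂ _++_ l₁ l₂ , (begin
      plug (plug t (s₁ ∷ s₂ ∷ [])) (List.map leafT (xs ++ ys))
        ≡⟨ cong (plug (plug t (s₁ ∷ s₂ ∷ []))) (map-++ leafT xs ys) ⟩
      plug (plug t (s₁ ∷ s₂ ∷ [])) (List.map leafT xs ++ List.map leafT ys)
        ≡⟨ plug-plug₂ t s₁ s₂ _ _ binary (trans (length-map leafT xs) lx) ⟩
      plug t (plug s₁ (List.map leafT xs) ∷ plug s₂ (List.map leafT ys) ∷ [])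
        ≡⟨ cong₂ (λ u v → plug t (u ∷ v ∷ [])) p₁ p₂ ⟩
      ⟦ e₁ ∙ e₂ ⟧ ∎)
    where open ≡-Reasoning

  leftNested rightNested : Term S
  leftNested  = plug t (plug t (port ∷ port ∷ []) ∷ port ∷ [])
  rightNested = plug t (port ∷ plug t (port ∷ port ∷ []) ∷ [])

  plug-leftNested : ∀ u v w → plug leftNested (u ∷ v ∷ w ∷ []) ≡ plug t (plug t (u ∷ v ∷ []) ∷ w ∷ [])
  plug-leftNested u v w =
    trans (plug-plug₂ t (plug t (port ∷ port ∷ [])) port (u ∷ v ∷ []) (w ∷ []) binary
                      (sym (ports-plug-pair port port)))
          (cong (λ r → plug t (r ∷ w ∷ [])) (plug-plug₂ t port port (u ∷ []) (v ∷ []) binary refl))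

  plug-rightNested : ∀ u v w → plug rightNested (u ∷ v ∷ w ∷ []) ≡ plug t (u ∷ plug t (v ∷ w ∷ []) ∷ [])
  plug-rightNested u v w =
    trans (plug-plug₂ t port (plug t (port ∷ port ∷ [])) (u ∷ []) (v ∷ w ∷ []) binary refl)
          (cong (λ r → plug t (u ∷ r ∷ [])) (plug-plug₂ t port port (v ∷ []) (w ∷ []) binary refl))

  module _ (L : Trees S → Set) where

    infix 4 _≈_

    _≈_ : Term S → Term S → Set
    u ≈ v = ∀ s → ports s ≡ 1 → InL L (plug s (u ∷ [])) ⇔ InL L (plug s (v ∷ []))

    ≈-isEquivalence : IsEquivalence _≈_
    ≈-isEquivalence = record
      { refl  = λ _ _ → ⇔.refl
      ; sym   = λ u≈v s one → ⇔.sym (u≈v s one)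
      ; trans = λ u≈v v≈w s one → ⇔.trans (u≈v s one) (v≈w s one)
      }
      where module ⇔ = IsEquivalence ⇔-isEquivalence

    ≈-setoid : Setoid _ _
    ≈-setoid = record { isEquivalence = ≈-isEquivalence }

    ≈-context : ∀ r {u v} → ports r ≡ 1 → u ≈ v → plug r (u ∷ []) ≈ plug r (v ∷ [])
    ≈-context r one u≈v s one′ =
      subst₂ _⇔_ (fill _) (fill _)
        (u≈v (plug s (r ∷ [])) (trans (ports-plug s (r ∷ []) (sym one′)) (trans (+-identityʳ _) one)))
      where
      fill : ∀ u → InL L (plug (plug s (r ∷ [])) (u ∷ [])) ≡ InL L (plug s (plug r (u ∷ []) ∷ []))
      fill u = cong (InL L) (plug-plug₁ s r (u ∷ []) one′ (sym one))

    ∙-congˡ : ∀ e f g → ⟦ e ⟧ ≈ ⟦ f ⟧ → ⟦ e ∙ g ⟧ ≈ ⟦ f ∙ g ⟧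
    ∙-congˡ e f g e≈f = subst₂ _≈_ (fill e) (fill f)
      (≈-context (plug t (port ∷ ⟦ g ⟧ ∷ []))
                 (trans (ports-plug-pair port ⟦ g ⟧) (cong suc (closed g))) e≈f)
      where
      fill : ∀ e → plug (plug t (port ∷ ⟦ g ⟧ ∷ [])) (⟦ e ⟧ ∷ []) ≡ ⟦ e ∙ g ⟧
      fill e = trans (plug-plug₂ t port ⟦ g ⟧ (⟦ e ⟧ ∷ []) [] binary refl)
                     (cong (λ v → plug t (⟦ e ⟧ ∷ v ∷ [])) (plug-[] ⟦ g ⟧))

    ∙-congʳ : ∀ e f g → ⟦ e ⟧ ≈ ⟦ f ⟧ → ⟦ g ∙ e ⟧ ≈ ⟦ g ∙ f ⟧
    ∙-congʳ e f g e≈f = subst₂ _≈_ (fill e) (fill f)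
      (≈-context (plug t (⟦ g ⟧ ∷ port ∷ []))
                 (trans (ports-plug-pair ⟦ g ⟧ port) (cong (_+ 1) (closed g))) e≈f)
      where
      fill : ∀ e → plug (plug t (⟦ g ⟧ ∷ port ∷ [])) (⟦ e ⟧ ∷ []) ≡ ⟦ g ∙ e ⟧
      fill e = trans (plug-plug₂ t ⟦ g ⟧ port [] (⟦ e ⟧ ∷ []) binary (sym (closed g)))
                     (cong (λ u → plug t (u ∷ ⟦ e ⟧ ∷ [])) (plug-[] ⟦ g ⟧))

    module Reassociation (nested-equiv : LEquiv L 3 leftNested rightNested) where

      ∙-assoc : ∀ e f g → ⟦ e ∙ f ∙ g ⟧ ≈ ⟦ e ∙ (f ∙ g) ⟧
      ∙-assoc e f g = closed-assoc (closed e) (closed f) (closed g)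
        where
        closed-assoc : ∀ {u v w} → ports u ≡ 0 → ports v ≡ 0 → ports w ≡ 0 →
                       plug t (plug t (u ∷ v ∷ []) ∷ w ∷ []) ≈ plug t (u ∷ plug t (v ∷ w ∷ []) ∷ [])
        closed-assoc {u} {v} {w} cu cv cw s one
          with du , refl ← closed⇒embed u cu | dv , refl ← closed⇒embed v cv | dw , refl ← closed⇒embed w cw =
          subst₂ _⇔_ (cong (λ r → InL L (plug s (r ∷ []))) (plug-leftNested u v w))
                     (cong (λ r → InL L (plug s (r ∷ []))) (plug-rightNested u v w))
                     (nested-equiv s one (du ∷ dv ∷ dw ∷ []))

      open SetoidReasoning ≈-setoid
      open Setoid ≈-setoid using () renaming (refl to ≈-refl; sym to ≈-sym)

      leftComb-cong : ∀ e f w → ⟦ e ⟧ ≈ ⟦ f ⟧ → ⟦ leftComb e w ⟧ ≈ ⟦ leftComb f w ⟧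
      leftComb-cong e f []      e≈f = e≈f
      leftComb-cong e f (τ ∷ w) e≈f = leftComb-cong _ _ w (∙-congˡ e f (letter τ) e≈f)

      ∙-leftComb : ∀ w e f → ⟦ e ∙ leftComb f w ⟧ ≈ ⟦ leftComb (e ∙ f) w ⟧
      ∙-leftComb []      e f = ≈-refl
      ∙-leftComb (ρ ∷ w) e f = begin
        ⟦ e ∙ leftComb (f ∙ letter ρ) w ⟧   ≈⟨ ∙-leftComb w e (f ∙ letter ρ) ⟩
        ⟦ leftComb (e ∙ (f ∙ letter ρ)) w ⟧ ≈⟨ leftComb-cong _ _ w (≈-sym (∙-assoc e f (letter ρ))) ⟩
        ⟦ leftComb (e ∙ f ∙ letter ρ) w ⟧   ∎

      normalise : ∀ e → ∃₂ λ σ w → letters e ≡ σ ∷ w × ⟦ e ⟧ ≈ ⟦ leftComb (letter σ) w ⟧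
      normalise (letter σ) = σ , [] , refl , ≈-refl
      normalise (e ∙ f) with σ , w , le , e≈ ← normalise e | τ , v , lf , f≈ ← normalise f =
        σ , w ++ τ ∷ v , cong₂ _++_ le lf , (begin
          ⟦ e ∙ f ⟧
            ≈⟨ ∙-congˡ e (leftComb (letter σ) w) f e≈ ⟩
          ⟦ leftComb (letter σ) w ∙ f ⟧
            ≈⟨ ∙-congʳ f (leftComb (letter τ) v) (leftComb (letter σ) w) f≈ ⟩
          ⟦ leftComb (letter σ) w ∙ leftComb (letter τ) v ⟧
            ≈⟨ ∙-leftComb v _ (letter τ) ⟩
          ⟦ leftComb (leftComb (letter σ) w ∙ letter τ) v ⟧
            ≡⟨ cong ⟦_⟧ (foldl-++ _ (letter σ) w (τ ∷ v)) ⟨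
          ⟦ leftComb (letter σ) (w ++ τ ∷ v) ⟧ ∎)

-- The left-to-right automaton

module WordAutomaton {S : RankedAlphabet} (A : DTWA S) (t : Term S) (binary : ports t ≡ 2) where
  open DTWA A using (nStates; q₀)
  open TreeWalking A
    using (Outcome; accepts; rejects; loops; exits; Behaviour; outcome; accepting; behaviourAlgebra; accepts⇔accepting)
  open Evaluation behaviourAlgebra using (eval; value; hom; value-embed)
  open Bracketings t binary

  outcome↪ : Outcome ↪ Fin (3 + nStates)
  outcome↪ = mk↪ₛ to from from-to
    where
    to : Outcome → Fin (3 + nStates)
    to accepts   = zero
    to rejects   = suc zero
    to loops     = suc (suc zero)
    to (exits q) = suc (suc (suc q))
    from : Fin (3 + nStates) → Outcome
    from zero                = accepts
    from (suc zero)          = rejects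
    from (suc (suc zero))    = loops
    from (suc (suc (suc q))) = exits q
    from-to : ∀ o → from (to o) ≡ o
    from-to accepts   = refl
    from-to rejects   = refl
    from-to loops     = refl
    from-to (exits q) = refl

  _⊙_ : Behaviour → Behaviour → Behaviour
  b ⊙ b′ = proj₁ (eval t (b ∷ b′ ∷ []))

  automaton : Automaton (Γ {S})
  automaton = record { State = Maybe Behaviour ; start = nothing ; step = step′ ; final = final′ }
    where
    step′ : Maybe Behaviour → Γ {S} → Maybe Behaviour
    step′ nothing  σ = just (value (leafT σ))
    step′ (just b) σ = just (b ⊙ value (leafT σ))
    final′ : Maybe Behaviour → Bool
    final′ nothing  = false
    final′ (just b) = accepting (outcome b nothing q₀)

  open Automaton automaton

  run-leftComb : ∀ w e → foldl step (just (value ⟦ e ⟧)) w ≡ just (value ⟦ leftComb e w ⟧)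
  run-leftComb []      e = refl
  run-leftComb (τ ∷ w) e =
    trans (cong (λ b → foldl step (just b) w) (sym (value-plug₂ t ⟦ e ⟧ (leafT τ) binary (closed e))))
          (run-leftComb w (e ∙ letter τ))
    where open Composition behaviourAlgebra using (value-plug₂)

  module _ (L : Trees S → Set) (recognises : (d : Trees S) → L d ⇔ Accepts A d)
           (nested-equiv : LEquiv L 3 leftNested rightNested) where
    open Reassociation L nested-equiv using (normalise)
    open SetoidReasoning (⇔-setoid 0ℓ)

    membership : ∀ {n} (σs : Vec (Γ {S}) n) {s} → InStar t s → ports s ≡ n →
                 Language (toList σs) ⇔ InL L (plug s (toList (map leafT σs)))
    membership σs {s} s∈t* ports-s
      with e , letters-e , plug-s ← star-bracketing s∈t* (toList σs) (trans (length-toList σs) (sym ports-s))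
      with σ , w , letters-σw , e≈comb ← normalise e
      with d , comb≡d ← closed⇒embed ⟦ leftComb (letter σ) w ⟧ (closed (leftComb (letter σ) w)) = begin
      Language (toList σs)
        ≡⟨ cong Language (trans (sym letters-e) letters-σw) ⟩
      final (foldl step (just (value ⟦ letter σ ⟧)) w) ≡ true
        ≡⟨ cong (λ b → final b ≡ true) (run-leftComb w (letter σ)) ⟩
      accepting (outcome (value ⟦ leftComb (letter σ) w ⟧) nothing q₀) ≡ true
        ≡⟨ cong (λ b → accepting (outcome b nothing q₀) ≡ true) (trans (cong value comb≡d) (value-embed d)) ⟩
      accepting (outcome (hom d) nothing q₀) ≡ true
        ≈⟨ accepts⇔accepting d ⟨
      Accepts A d
        ≈⟨ recognises d ⟨
      L d
        ≡⟨ trans (cong (InL L) comb≡d) (InL-embed L d) ⟨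
      InL L ⟦ leftComb (letter σ) w ⟧
        ≈⟨ e≈comb port refl ⟨
      InL L ⟦ e ⟧
        ≡⟨ cong (InL L) (trans (cong (plug s) (toList-map leafT σs)) plug-s) ⟨
      InL L (plug s (toList (map leafT σs))) ∎

lemma5 : (S : RankedAlphabet) (a c : Letter S) → arity S a ≡ 2 → arity S c ≡ 0 →
    (L : Trees S → Set) → DTWARecognisable L →
    (t : Term S) → OverAC a c t → ports t ≡ 2 →
    LEquiv L 3 (plug t (plug t (port ∷ port ∷ []) ∷ port ∷ []))
               (plug t (port ∷ plug t (port ∷ port ∷ []) ∷ [])) →
    ∃ λ (K : List (Γ {S}) → Set) → Regular K ×
      ((n : ℕ) → 2 ≤ n → (σs : Vec (Γ {S}) n) → (s : Term S) →
        InStar t s → ports s ≡ n →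
        (K (toList σs) ⇔ InL L (plug s (toList (map leafT σs)))))
lemma5 S _ _ _ _ L (A , recognises) t _ binary nested-equiv =
  Language , automaton-regular automaton (maybe↪ (vec↪ (vec↪ outcome↪))) ,
  λ n _ σs s s∈t* ports-s → membership L recognises nested-equiv σs s∈t* ports-s
  where open WordAutomaton A t binary
        open Automaton automaton using (Language)
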